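{- Let $k$ be a positive integer and let $n$ be an integer with $k^2-k+1\le n\le k^2$. Let $\delta(n)=\min\{r+s\mid r,s\in\mathbb N_0,\ r\le s,\ rs=n\}$. Then: (i) $\delta(n)\ge 2k$. (ii) $\delta(n)=2k$ if and only if $n=k^2-l^2$ for some $l\in\mathbb N_0$ with $l^2\le k-1$.
   Context: $\mathbb N_0$ denotes the set of non-negative integers. -}

module Defs where

open import Data.Nat using (ℕ; _+_; _*_; _≤_)
open import Data.Product using (Σ; _×_)
open import Relation.Binary.PropositionalEquality using (_≡_)

FactorPair : ℕ → ℕ → ℕ → Set
FactorPair n r s = (r ≤ s) × (r * s ≡ n)

IsDelta : ℕ → ℕ → Set
IsDelta n d =
  (Σ ℕ λ r → Σ ℕ λ s → FactorPair n r s × (r + s ≡ d))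
  × (∀ r s → FactorPair n r s → d ≤ r + s)

-- By AM-GM, 4rs ≤ (r + s)², so r s = n > k² − k forces (r + s)² > 4k² − 4k + 1 = (2k − 1)²,
-- i.e. r + s ≥ 2k.  A factor pair with r + s = 2k is (k − l, k + l) for some l, with
-- product k² − l², and k² − l² > k² − k exactly when l² < k.
module Submission where

open import Defs
open import Data.Nat using (ℕ; zero; suc; _+_; _*_; _∸_; _≤_; _<_; z≤n; s≤s)
open import Data.Nat.Properties
open import Data.Nat.Solver using (module +-*-Solver)
open import Data.Product using (Σ; ∃-syntax; _×_; _,_)
open import Data.Sum using ([_,_]′)
open import Function.Bundles using (_⇔_; mk⇔)
open import Relation.Binary.PropositionalEquality
open +-*-Solver

[m+n]*[m+n]≡m*[m+2*n]+n*n : ∀ m n → (m + n) * (m + n) ≡ m * (m + 2 * n) + n * n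
[m+n]*[m+n]≡m*[m+2*n]+n*n = solve 2 (λ m n →
  (m :+ n) :* (m :+ n) := m :* (m :+ con 2 :* n) :+ n :* n) refl

4*[m*n]≤[m+n]*[m+n] : ∀ m n → 4 * (m * n) ≤ (m + n) * (m + n)
4*[m*n]≤[m+n]*[m+n] m n = [ ordered , swapped ]′ (≤-total m n)
  where
  square-of-sum : ∀ m t → 4 * (m * (m + t)) + t * t ≡ (m + (m + t)) * (m + (m + t))
  square-of-sum = solve 2 (λ m t →
    con 4 :* (m :* (m :+ t)) :+ t :* t := (m :+ (m :+ t)) :* (m :+ (m :+ t))) refl

  ordered : ∀ {m n} → m ≤ n → 4 * (m * n) ≤ (m + n) * (m + n)
  ordered {m} m≤n with m≤n⇒∃[o]m+o≡n m≤n
  ... | t , refl = subst (4 * (m * (m + t)) ≤_) (square-of-sum m t) (m≤m+n _ (t * t))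

  swapped : n ≤ m → 4 * (m * n) ≤ (m + n) * (m + n)
  swapped n≤m = subst₂ (λ a b → 4 * a ≤ b * b) (*-comm n m) (+-comm n m) (ordered n≤m)

m*m<n*n⇒m<n : ∀ {m n} → m * m < n * n → m < n
m*m<n*n⇒m<n mm<nn = ≰⇒> (λ n≤m → <⇒≱ mm<nn (*-mono-≤ n≤m n≤m))

k*k∸k<m*n⇒2*k≤m+n : ∀ k {m n} → k * k ∸ k < m * n → 2 * k ≤ m + n
k*k∸k<m*n⇒2*k≤m+n zero    _ = z≤n
k*k∸k<m*n⇒2*k≤m+n (suc j) {m} {n} k*k∸k<mn =
  subst (_≤ m + n) (sym (*-suc 2 j)) (m*m<n*n⇒m<n (begin-strict
    (1 + 2 * j) * (1 + 2 * j)       <⟨ m<m+n _ (s≤s z≤n) ⟩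
    (1 + 2 * j) * (1 + 2 * j) + 3   ≡⟨ odd-square j ⟩
    4 * suc (suc j * j)             ≡⟨ cong (λ x → 4 * suc x) (sym k*k∸k≡k*j) ⟩
    4 * suc (suc j * suc j ∸ suc j) ≤⟨ *-monoʳ-≤ 4 k*k∸k<mn ⟩
    4 * (m * n)                     ≤⟨ 4*[m*n]≤[m+n]*[m+n] m n ⟩
    (m + n) * (m + n)               ∎))
  where
  open ≤-Reasoning
  odd-square : ∀ j → (1 + 2 * j) * (1 + 2 * j) + 3 ≡ 4 * suc (suc j * j)
  odd-square = solve 1 (λ j →
    (con 1 :+ con 2 :* j) :* (con 1 :+ con 2 :* j) :+ con 3 := con 4 :* (con 1 :+ (con 1 :+ j) :* j)) refl

  k*k∸k≡k*j : suc j * suc j ∸ suc j ≡ suc j * j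
  k*k∸k≡k*j = trans (cong (_∸ suc j) (*-suc (suc j) j)) (m+n∸m≡n (suc j) (suc j * j))

m+n≡o⇒m≡o∸n : ∀ {m n o} → m + n ≡ o → m ≡ o ∸ n
m+n≡o⇒m≡o∸n {m} {n} refl = sym (m+n∸n≡m m n)

m≤n⇒m+n≡2*k⇒∃[l]m*n+l*l≡k*k : ∀ {m n k} → m ≤ n → m + n ≡ 2 * k → ∃[ l ] m * n + l * l ≡ k * k
m≤n⇒m+n≡2*k⇒∃[l]m*n+l*l≡k*k {m} {k = k} m≤n m+n≡2k with m≤n⇒∃[o]m+o≡n m≤n
... | t , refl = centre (m≤n⇒∃[o]m+o≡n m≤k) m+n≡2k
  where
  2*m+t≡m+[m+t] : 2 * m + t ≡ m + (m + t)
  2*m+t≡m+[m+t] = solve 2 (λ m t → con 2 :* m :+ t := m :+ (m :+ t)) refl m t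

  m≤k : m ≤ k
  m≤k = *-cancelˡ-≤ 2 (subst (2 * m ≤_) (trans 2*m+t≡m+[m+t] m+n≡2k) (m≤m+n (2 * m) t))

  centre : ∃[ l ] m + l ≡ k → m + (m + t) ≡ 2 * k → ∃[ l ] m * (m + t) + l * l ≡ k * k
  centre (l , refl) m+[m+t]≡2k = l , (begin
    m * (m + t) + l * l     ≡⟨ cong (λ x → m * (m + x) + l * l) t≡2*l ⟩
    m * (m + 2 * l) + l * l ≡⟨ sym ([m+n]*[m+n]≡m*[m+2*n]+n*n m l) ⟩
    (m + l) * (m + l)       ∎)
    where
    open ≡-Reasoning
    t≡2*l : t ≡ 2 * l
    t≡2*l = +-cancelˡ-≡ (2 * m) t (2 * l) (begin
      2 * m + t     ≡⟨ 2*m+t≡m+[m+t] ⟩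
      m + (m + t)   ≡⟨ m+[m+t]≡2k ⟩
      2 * (m + l)   ≡⟨ *-distribˡ-+ 2 m l ⟩
      2 * m + 2 * l ∎)

centred-factor-pair : ∀ {k} m l → m + l ≡ k →
  FactorPair (k * k ∸ l * l) m (m + 2 * l) × (m + (m + 2 * l) ≡ 2 * k)
centred-factor-pair m l refl = (m≤m+n m (2 * l) , product) , sum
  where
  product : m * (m + 2 * l) ≡ (m + l) * (m + l) ∸ l * l
  product = m+n≡o⇒m≡o∸n (sym ([m+n]*[m+n]≡m*[m+2*n]+n*n m l))

  sum : m + (m + 2 * l) ≡ 2 * (m + l)
  sum = solve 2 (λ m l → m :+ (m :+ con 2 :* l) := con 2 :* (m :+ l)) refl m l

proposition6p3 : (k n : ℕ) → 0 < k → (k * k ∸ k) + 1 ≤ n → n ≤ k * k →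
    (d : ℕ) → IsDelta n d →
    (2 * k ≤ d)
    × ((d ≡ 2 * k) ⇔ (Σ ℕ λ l → (l * l ≤ k ∸ 1) × (n ≡ k * k ∸ l * l)))
proposition6p3 k@(suc j) n _ k*k∸k+1≤n _ d ((r , s , (r≤s , rs≡n) , r+s≡d) , minimal) =
  2*k≤d , mk⇔ to from
  where
  k*k∸k<n : k * k ∸ k < n
  k*k∸k<n = subst (_≤ n) (+-comm (k * k ∸ k) 1) k*k∸k+1≤n

  2*k≤d : 2 * k ≤ d
  2*k≤d = subst (2 * k ≤_) r+s≡d (k*k∸k<m*n⇒2*k≤m+n k {r} {s} (subst (k * k ∸ k <_) (sym rs≡n) k*k∸k<n))

  to : d ≡ 2 * k → Σ ℕ λ l → (l * l ≤ k ∸ 1) × (n ≡ k * k ∸ l * l)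
  to d≡2k with m≤n⇒m+n≡2*k⇒∃[l]m*n+l*l≡k*k r≤s (trans r+s≡d d≡2k)
  ... | l , rs+l*l≡k*k = l , <⇒≤pred l*l<k , n≡k*k∸l*l
    where
    n≡k*k∸l*l : n ≡ k * k ∸ l * l
    n≡k*k∸l*l = m+n≡o⇒m≡o∸n (subst (λ x → x + l * l ≡ k * k) rs≡n rs+l*l≡k*k)
    l*l<k : l * l < k
    l*l<k = ∸-cancelʳ-< {k} {l * l} {k * k} (subst (k * k ∸ k <_) n≡k*k∸l*l k*k∸k<n)

  from : (Σ ℕ λ l → (l * l ≤ k ∸ 1) × (n ≡ k * k ∸ l * l)) → d ≡ 2 * k
  from (l , l*l≤j , refl) =
    let pair , sum = centred-factor-pair (k ∸ l) l (m∸n+n≡m (<⇒≤ l<k))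
    in ≤-antisym (subst (d ≤_) sum (minimal (k ∸ l) _ pair)) 2*k≤d
    where
    l<k : l < k
    l<k = m*m<n*n⇒m<n (<-≤-trans (s≤s l*l≤j) (m≤m*n k k))
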